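{- Let $G$ be a finite simple connected graph with $n$ vertices, equipped with a closed labeling $V(G)=[n]$, and let $E_1<E_2<\cdots<E_r$ be its exchangeability equivalence classes, ordered so that for $i\in E_a$ and $j\in E_b$ we have $i<j$ if and only if $a<b$. Let $G/\!\sim$ be the graph with vertex set $\{E_1,\dots,E_r\}$ in which $\{E_a,E_b\}$ (with $a\neq b$) is an edge if and only if $\{i,j\}\in E(G)$ for some $i\in E_a$, $j\in E_b$. Then: (1) $G/\!\sim$ is connected, collapsed, and closed with respect to the labeling $E_a\mapsto a$. (2) If $r>1$, then $G$ has precisely $2\prod_{a=1}^r |E_a|!$ closed labelings.
   Context: All graphs are finite and simple. A labeling of a graph $G$ with $n$ vertices is a bijection $V(G)\to[n]=\{1,\dots,n\}$; given a labeling we identify $V(G)=[n]$. A labeling is closed if whenever $\{j,i\},\{i,k\}\in E(G)$ with $j\neq k$ and either $j>i<k$ or $j<i>k$, then $\{j,k\}\in E(G)$. A graph is closed if it has a closed labeling. The full neighborhood of a vertex $v$ is $N_G[v]=\{v\}\cup N_G(v)$, where $N_G(v)$ is the set of neighbors of $v$. Vertices $v,w$ are exchangeable, $v\sim w$, if $N_G[v]=N_G[w]$; this is an equivalence relation. A graph is collapsed if $N_G[v]=N_G[w]$ implies $v=w$. For a connected graph with a closed labeling, each equivalence class of $\sim$ is an interval $\{k: i\le k\le j\}$ of $[n]$, which is what makes the ordering $E_1<\cdots<E_r$ well defined. -}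

module Defs where

open import Level using (0ℓ)
open import Data.Nat using (ℕ; zero; suc; _*_; _!)
open import Data.Fin using (Fin; _<_; _≟_)
open import Data.List using (List; length; filter; map; allFin)
open import Data.Nat.ListAction using (product)
open import Data.List.Membership.Propositional using (_∈_)
open import Data.List.Relation.Unary.Unique.Propositional using (Unique)
open import Data.Vec using (Vec; lookup)
open import Data.Product using (Σ; ∃; ∃-syntax; _×_; _,_)
open import Data.Sum using (_⊎_)
open import Relation.Binary.PropositionalEquality using (_≡_; _≢_)
open import Relation.Nullary using (¬_)
open import Function.Bundles using (_⇔_)

-- A finite simple graph on the vertex set Fin n (= [n] via i ↦ toℕ i + 1):
-- a symmetric irreflexive adjacency relation.
record Graph (n : ℕ) : Set₁ where
  field
    Adj   : Fin n → Fin n → Set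
    sym   : ∀ {u v} → Adj u v → Adj v u
    irrefl : ∀ {u} → ¬ Adj u u
open Graph public

data Walk {n : ℕ} (G : Graph n) : Fin n → Fin n → Set where
  here : ∀ {u} → Walk G u u
  step : ∀ {u w v} → Adj G u w → Walk G w v → Walk G u v

Connected : ∀ {n} → Graph n → Set
Connected G = ∀ u v → Walk G u v

InN[_] : ∀ {n} (G : Graph n) → Fin n → Fin n → Set
InN[ G ] v x = x ≡ v ⊎ Adj G v x

Exch : ∀ {n} → Graph n → Fin n → Fin n → Set
Exch G v w = ∀ x → InN[ G ] v x ⇔ InN[ G ] w x

Collapsed : ∀ {n} → Graph n → Set
Collapsed G = ∀ v w → Exch G v w → v ≡ w

-- a labeling V(G) → [n] given as a function σ (bijectivity is imposed separately);
-- σ is closed if for edges {j,i},{i,k} with j ≠ k and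
-- (σ j > σ i < σ k or σ j < σ i > σ k) we have {j,k} ∈ E(G).
IsClosedLabeling : ∀ {n} → Graph n → (Fin n → Fin n) → Set
IsClosedLabeling G σ =
  ∀ j i k → Adj G j i → Adj G i k → j ≢ k →
  ((σ i < σ j × σ i < σ k) ⊎ (σ j < σ i × σ k < σ i)) →
  Adj G j k

-- labelings represented as vectors of images (so that equality is decidable/structural)
Bijective : ∀ {n} → (Fin n → Fin n) → Set
Bijective f = (∀ x y → f x ≡ f y → x ≡ y) × (∀ y → ∃[ x ] f x ≡ y)

IsClosedLabelingVec : ∀ {n} → Graph n → Vec (Fin n) n → Set
IsClosedLabelingVec G σ = Bijective (lookup σ) × IsClosedLabeling G (lookup σ)

HasExactly : ∀ {n} → Graph n → ℕ → Set
HasExactly {n} G N =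
  Σ (List (Vec (Fin n) n)) λ L →
    Unique L × (∀ σ → (σ ∈ L) ⇔ IsClosedLabelingVec G σ) × length L ≡ N

-- quotient graph G/~ given the class map cls (vertex i ∈ E_a iff cls i ≡ a)
quotient : ∀ {n r} → Graph n → (Fin n → Fin r) → Graph r
quotient {n} {r} G cls = record
  { Adj = λ a b → a ≢ b × ∃[ i ] ∃[ j ] (cls i ≡ a × cls j ≡ b × Adj G i j)
  ; sym = λ { (a≢b , i , j , ci , cj , e) →
              (λ eq → a≢b (symm eq)) , j , i , cj , ci , Graph.sym G e }
  ; irrefl = λ { (a≢a , _) → a≢a Relation.Binary.PropositionalEquality.refl }
  }
  where
  symm = Relation.Binary.PropositionalEquality.sym

classSize : ∀ {n r} → (Fin n → Fin r) → Fin r → ℕ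
classSize {n} cls a = length (filter (λ i → cls i ≟ a) (allFin n))

prodFact : ∀ {n r} → (Fin n → Fin r) → ℕ
prodFact {n} {r} cls = product (map (λ a → classSize cls a !) (allFin r))

module Submission where

-- In a connected graph with a closed labeling σ every walk can be shortened to one along which
-- σ is monotone: an edge against the direction of the walk is bypassed using closedness at
-- its lower end.  Hence σ has the umbrella property (σ a < σ b < σ c and a ~ c give a ~ b and
-- b ~ c), and the middle vertex of an induced path lies σ-between its ends.
--
-- Part (1) follows by pushing walks, closed neighbourhoods and the closedness condition
-- through the class map.  For part (2) let σ be any closed labeling.  Using the umbrella
-- property of both labelings, a non-edge i < j can be widened edge by edge without changing
-- the direction in which σ orders it, so σ orders all non-edges the same way.  An edge x y
-- between different classes has a vertex adjacent to exactly one of x, y; with x and y it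
-- forms an induced path whose ends are a non-edge, so σ orders x y that way too.  Thus σ is
-- increasing or decreasing from class to class.  Conversely every such bijection is closed;
-- the increasing ones are exactly the class-preserving permutations, of which there are
-- ∏ |E_a|!, and the decreasing ones are their mirror images.

open import Defs hiding (sym)
open import Data.Bool using (Bool; true; false; not)
import Data.Bool.Properties as Bool
open import Data.Empty using (⊥; ⊥-elim)
open import Data.Fin using (Fin; zero; suc; _<_; _≤_; _≤?_; _≟_; opposite)
open import Data.Fin.Properties
  using (<-trans; <-irrefl; <-asym; <-cmp; ≤-total; ≤-refl; ≤-reflexive; ≤∧≢⇒<; <⇒≢; toℕ<n;
         suc-injective; opposite-prop; opposite-involutive; any?; all?; ¬∀⟶∃¬)
open import Data.List as List using (List; []; _∷_; [_]; _++_; length; filter; map; concatMap; tabulate)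
open import Data.List.Properties
  using (length-++; length-map; map-tabulate; tabulate-cong; filter-accept; filter-reject; filter-notAll)
open import Data.List.Membership.Propositional using (_∈_)
open import Data.List.Membership.Propositional.Properties
  using (∈-filter⁺; ∈-filter⁻; ∈-map⁺; ∈-map⁻; ∈-++⁺ˡ; ∈-++⁺ʳ; ∈-++⁻; ∈-allFin)
import Data.List.Membership.DecPropositional as DecMembership
open import Data.List.Relation.Binary.Subset.Propositional using (_⊆_)
open import Data.List.Relation.Unary.All as All using (All; []; _∷_)
open import Data.List.Relation.Unary.All.Properties using (¬Any⇒All¬)
open import Data.List.Relation.Unary.AllPairs using ([]; _∷_)
open import Data.List.Relation.Unary.Any as Any using (here; there)
open import Data.List.Relation.Unary.Unique.Propositional using (Unique)
import Data.List.Relation.Unary.Unique.Propositional.Properties as Unique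
import Data.Nat
open import Data.Nat as ℕ using (ℕ; zero; suc; _+_; _*_; _∸_; _!; s≤s; z≤n)
open import Data.Nat.Combinatorics.Base using (_P′_)
open import Data.Nat.Combinatorics.Specification using (nP′n≡n!)
open import Data.Nat.ListAction using (product)
import Data.Nat.Properties as ℕₚ
open import Algebra.Properties.CommutativeSemigroup ℕₚ.*-commutativeSemigroup using (x∙yz≈y∙xz)
open import Data.Product using (∃-syntax; ∃₂; _×_; _,_; proj₁; proj₂)
open import Data.Sum using (_⊎_; inj₁; inj₂)
open import Data.Vec as Vec using (Vec; []; _∷_; lookup; toList)
open import Data.Vec.Properties
  using (∷-injective; ≡-dec; lookup-allFin; lookup-map; tabulate∘lookup; map-∘; map-cong; map-id)
open import Data.Vec.Membership.Propositional using () renaming (_∉_ to _∉ᵛ_)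
open import Data.Vec.Membership.Propositional.Properties using (∈-toList⁺; ∈-toList⁻)
open import Data.Vec.Relation.Binary.Pointwise.Inductive as Pointwise using (Pointwise; []; _∷_)
open import Data.Vec.Relation.Unary.All using ([]; _∷_) renaming (All to Allᵛ)
import Data.Vec.Relation.Unary.All.Properties as Allᵛ
open import Data.Vec.Relation.Unary.AllPairs using ([]; _∷_)
open import Data.Vec.Relation.Unary.Any using (here; there)
open import Data.Vec.Relation.Unary.Unique.Propositional using () renaming (Unique to Uniqueᵛ)
import Data.Vec.Relation.Unary.Unique.Propositional.Properties as Uniqueᵛ
open import Function using (id; _∘_)
open import Function.Bundles using (_⇔_; mk⇔; Equivalence)
import Function.Properties.Equivalence as ⇔
open import Level using (0ℓ)
open import Relation.Binary.Definitions using (DecidableEquality; tri<; tri≈; tri>)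
open import Relation.Binary.PropositionalEquality
  using (_≡_; _≢_; refl; sym; trans; cong; cong₂; subst; subst₂; module ≡-Reasoning)
open import Relation.Nullary using (¬_; Dec; yes; no; contradiction)
open import Relation.Nullary.Decidable using (¬?; _⊎-dec_; _→-dec_; decidable-stable; ¬¬-excluded-middle)
open import Relation.Unary using (Pred; Decidable)

module _ {A : Set} (_≟ᴬ_ : DecidableEquality A) where

  unique-⊆⇒length≤ : ∀ {xs ys : List A} → Unique xs → xs ⊆ ys → length xs ℕ.≤ length ys
  unique-⊆⇒length≤ {[]} _ _ = z≤n
  unique-⊆⇒length≤ {x ∷ xs} {ys} (x∉xs ∷ xs-unique) xs⊆ys =
    ℕₚ.≤-trans (s≤s (unique-⊆⇒length≤ xs-unique xs⊆ys∖x))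
               (filter-notAll (λ z → ¬? (z ≟ᴬ x)) ys
                  (Any.map (λ { refl ¬z≡z → ¬z≡z refl }) (xs⊆ys (here refl))))
    where
    xs⊆ys∖x : xs ⊆ filter (λ z → ¬? (z ≟ᴬ x)) ys
    xs⊆ys∖x z∈xs =
      ∈-filter⁺ (λ z → ¬? (z ≟ᴬ x)) (xs⊆ys (there z∈xs)) (λ { refl → All.lookup x∉xs z∈xs refl })

  unique-⊆⊇⇒length≡ : ∀ {xs ys : List A} → Unique xs → Unique ys → xs ⊆ ys → ys ⊆ xs →
                      length xs ≡ length ys
  unique-⊆⊇⇒length≡ xs-unique ys-unique xs⊆ys ys⊆xs =
    ℕₚ.≤-antisym (unique-⊆⇒length≤ xs-unique xs⊆ys) (unique-⊆⇒length≤ ys-unique ys⊆xs)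

module _ {n : ℕ} {σ : Fin n → Fin n} (σ-injective : ∀ x y → σ x ≡ σ y → x ≡ y) where

  injective-reflects : ∀ {P : Pred (Fin n) 0ℓ} → Decidable P → (∀ q → P q → P (σ q)) →
                       ∀ p → P (σ p) → P p
  injective-reflects {P} P? preserves p Pσp with P? p
  ... | yes Pp = Pp
  ... | no ¬Pp = ⊥-elim (ℕₚ.<-irrefl refl (subst (ℕ._≤ length X) (cong suc (length-map σ X))
                   (unique-⊆⇒length≤ _≟_ (Unique.map⁺ (σ-injective _ _) (p∉X ∷ X-unique))
                                          σ[p∷X]⊆X)))
    where
    X = filter P? (List.allFin n)
    X-unique : Unique X
    X-unique = Unique.filter⁺ P? (Unique.allFin⁺ n)
    ∈X⇒P : ∀ {q} → q ∈ X → P q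
    ∈X⇒P = proj₂ ∘ ∈-filter⁻ P? {xs = List.allFin n}
    p∉X : All (p ≢_) X
    p∉X = ¬Any⇒All¬ X (¬Pp ∘ ∈X⇒P)
    σ[p∷X]⊆X : map σ (p ∷ X) ⊆ X
    σ[p∷X]⊆X z∈σ[p∷X] with ∈-map⁻ σ z∈σ[p∷X]
    ... | q , here refl , refl = ∈-filter⁺ P? (∈-allFin (σ p)) Pσp
    ... | q , there q∈X , refl = ∈-filter⁺ P? (∈-allFin (σ q)) (preserves q (∈X⇒P q∈X))

  injective⇒surjective : ∀ y → ∃[ x ] σ x ≡ y
  injective⇒surjective y = injective-reflects (λ q → any? (λ x → σ x ≟ q)) (λ q _ → q , refl) y (y , refl)

¬¬-∀-Fin : ∀ {n} {P : Fin n → Set} → (∀ i → ¬ ¬ P i) → ¬ ¬ (∀ i → P i)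
¬¬-∀-Fin {zero} _ ¬∀ = ¬∀ λ ()
¬¬-∀-Fin {suc n} {P} ¬¬P ¬∀ =
  ¬¬P zero λ P₀ → ¬¬-∀-Fin (¬¬P ∘ suc) λ P₊ → ¬∀ λ { zero → P₀ ; (suc i) → P₊ i }

¬¬-decidable : ∀ {n} (R : Fin n → Fin n → Set) → ¬ ¬ (∀ u v → Dec (R u v))
¬¬-decidable R = ¬¬-∀-Fin λ u → ¬¬-∀-Fin λ v → ¬¬-excluded-middle

lower-bound : ∀ {n} (a b : Fin n) → ∃[ c ] c ≤ a × c ≤ b
lower-bound a b with ≤-total a b
... | inj₁ a≤b = a , ≤-refl , a≤b
... | inj₂ b≤a = b , b≤a , ≤-refl

upper-bound : ∀ {n} (a b : Fin n) → ∃[ c ] a ≤ c × b ≤ c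
upper-bound a b with ≤-total a b
... | inj₁ a≤b = b , a≤b , ≤-refl
... | inj₂ b≤a = a , ≤-refl , b≤a

opposite-< : ∀ {n} {i j : Fin n} → i < j → opposite j < opposite i
opposite-< {n} {i} {j} i<j =
  subst₂ ℕ._<_ (sym (opposite-prop j)) (sym (opposite-prop i)) (ℕₚ.∸-monoʳ-< (s≤s i<j) (toℕ<n j))

length-filter-partition : ∀ {A : Set} {p} {P : Pred A p} (P? : Decidable P) xs →
  length (filter P? xs) + length (filter (¬? ∘ P?) xs) ≡ length xs
length-filter-partition P? [] = refl
length-filter-partition P? (x ∷ xs) with P? x
... | yes _ = cong suc (length-filter-partition P? xs)
... | no _ = trans (ℕₚ.+-suc _ _) (cong suc (length-filter-partition P? xs))

product-tabulate-update : ∀ {r} (f g : Fin r → ℕ) (c : Fin r) {k} →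
  f c ≡ k * g c → (∀ a → a ≢ c → f a ≡ g a) → product (tabulate f) ≡ k * product (tabulate g)
product-tabulate-update {suc r} f g zero {k} fc others = begin
  f zero * product (tabulate (f ∘ suc))
    ≡⟨ cong₂ _*_ fc (cong product (tabulate-cong (λ a → others (suc a) λ ()))) ⟩
  k * g zero * product (tabulate (g ∘ suc))   ≡⟨ ℕₚ.*-assoc k _ _ ⟩
  k * (g zero * product (tabulate (g ∘ suc))) ∎
  where open ≡-Reasoning
product-tabulate-update {suc r} f g (suc c) {k} fc others = begin
  f zero * product (tabulate (f ∘ suc))
    ≡⟨ cong₂ _*_ (others zero λ ())
         (product-tabulate-update (f ∘ suc) (g ∘ suc) c {k} fc
            (λ a a≢c → others (suc a) (a≢c ∘ suc-injective))) ⟩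
  g zero * (k * product (tabulate (g ∘ suc))) ≡⟨ x∙yz≈y∙xz (g zero) k _ ⟩
  k * (g zero * product (tabulate (g ∘ suc))) ∎
  where open ≡-Reasoning

module _ {A : Set} where

  toList-tabulate : ∀ {m} (f : Fin m → A) → toList (Vec.tabulate f) ≡ tabulate f
  toList-tabulate {zero} f = refl
  toList-tabulate {suc m} f = cong (f zero ∷_) (toList-tabulate (f ∘ suc))

  ∉⇒All≢ : ∀ {m} {y : A} {ys : Vec A m} → y ∉ᵛ ys → Allᵛ (y ≢_) ys
  ∉⇒All≢ {ys = []} _ = []
  ∉⇒All≢ {ys = _ ∷ _} y∉ys = (y∉ys ∘ here) ∷ ∉⇒All≢ (y∉ys ∘ there)

  All≢⇒∉ : ∀ {m} {y : A} {ys : Vec A m} → Allᵛ (y ≢_) ys → y ∉ᵛ ys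
  All≢⇒∉ (y≢z ∷ _) (here y≡z) = y≢z y≡z
  All≢⇒∉ (_ ∷ y≢zs) (there y∈zs) = All≢⇒∉ y≢zs y∈zs

  toList-unique : ∀ {m} {ys : Vec A m} → Uniqueᵛ ys → Unique (toList ys)
  toList-unique [] = []
  toList-unique (y≢ys ∷ ys-unique) = Allᵛ.toList⁺ y≢ys ∷ toList-unique ys-unique

  module _ {m} (f : Vec A m → List A) where

    extensions : List (Vec A m) → List (Vec A (suc m))
    extensions = concatMap (λ ys → map (_∷ ys) (f ys))

    ∈-extensions⁺ : ∀ {L y ys} → ys ∈ L → y ∈ f ys → (y ∷ ys) ∈ extensions L
    ∈-extensions⁺ {zs ∷ L} (here refl) y∈f = ∈-++⁺ˡ (∈-map⁺ (_∷ zs) y∈f)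
    ∈-extensions⁺ {zs ∷ L} (there ys∈L) y∈f = ∈-++⁺ʳ (map (_∷ zs) (f zs)) (∈-extensions⁺ ys∈L y∈f)

    ∈-extensions⁻ : ∀ L {y ys} → (y ∷ ys) ∈ extensions L → ys ∈ L × y ∈ f ys
    ∈-extensions⁻ (zs ∷ L) y∷ys∈ with ∈-++⁻ (map (_∷ zs) (f zs)) y∷ys∈
    ... | inj₁ y∷ys∈f with ∈-map⁻ (_∷ zs) y∷ys∈f
    ...   | _ , y∈f , refl = here refl , y∈f
    ∈-extensions⁻ (zs ∷ L) y∷ys∈ | inj₂ y∷ys∈ext =
      let ys∈L , y∈f = ∈-extensions⁻ L y∷ys∈ext in there ys∈L , y∈f

    extensions-unique : ∀ {L} → Unique L → (∀ ys → Unique (f ys)) → Unique (extensions L)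
    extensions-unique {[]} _ _ = []
    extensions-unique {zs ∷ L} (zs∉L ∷ L-unique) f-unique =
      Unique.++⁺ (Unique.map⁺ (proj₁ ∘ ∷-injective) (f-unique zs))
                 (extensions-unique L-unique f-unique) disjoint
      where
      disjoint : ∀ {v} → ¬ (v ∈ map (_∷ zs) (f zs) × v ∈ extensions L)
      disjoint (v∈f , v∈ext) with ∈-map⁻ (_∷ zs) v∈f
      ... | _ , _ , refl = All.lookup zs∉L (proj₁ (∈-extensions⁻ L v∈ext)) refl

    length-extensions : ∀ L k → (∀ {ys} → ys ∈ L → length (f ys) ≡ k) →
                        length (extensions L) ≡ length L * k
    length-extensions [] k _ = refl
    length-extensions (ys ∷ L) k constant = begin
      length (map (_∷ ys) (f ys) ++ extensions L)          ≡⟨ length-++ (map (_∷ ys) (f ys)) ⟩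
      length (map (_∷ ys) (f ys)) + length (extensions L)
        ≡⟨ cong₂ _+_ (trans (length-map _ (f ys)) (constant (here refl)))
                     (length-extensions L k (constant ∘ there)) ⟩
      k + length L * k                                     ∎
      where open ≡-Reasoning

mirror : ∀ {n} → Vec (Fin n) n → Vec (Fin n) n
mirror = Vec.map opposite

lookup-mirror : ∀ {n} (v : Vec (Fin n) n) i → lookup (mirror v) i ≡ opposite (lookup v i)
lookup-mirror v i = lookup-map i opposite v

mirror-involutive : ∀ {n} (v : Vec (Fin n) n) → mirror (mirror v) ≡ v
mirror-involutive v =
  trans (sym (map-∘ opposite opposite v)) (trans (map-cong opposite-involutive v) (map-id v))

mirror-injective : ∀ {n} {v w : Vec (Fin n) n} → mirror v ≡ mirror w → v ≡ w
mirror-injective {v = v} {w} eq =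
  trans (sym (mirror-involutive v)) (trans (cong mirror eq) (mirror-involutive w))

lookup-mirror-< : ∀ {n} (v : Vec (Fin n) n) {x y} → lookup v x < lookup v y →
                  lookup (mirror v) y < lookup (mirror v) x
lookup-mirror-< v {x} {y} lt =
  subst₂ _<_ (sym (lookup-mirror v y)) (sym (lookup-mirror v x)) (opposite-< lt)

lookup-mirror-injective : ∀ {n} (v : Vec (Fin n) n) → (∀ x y → lookup v x ≡ lookup v y → x ≡ y) →
                          ∀ x y → lookup (mirror v) x ≡ lookup (mirror v) y → x ≡ y
lookup-mirror-injective v injective x y eq = injective x y (begin
  lookup v x                       ≡⟨ opposite-involutive (lookup v x) ⟨
  opposite (opposite (lookup v x)) ≡⟨ cong opposite (lookup-mirror v x) ⟨
  opposite (lookup (mirror v) x)   ≡⟨ cong opposite eq ⟩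
  opposite (lookup (mirror v) y)   ≡⟨ cong opposite (lookup-mirror v y) ⟩
  opposite (opposite (lookup v y)) ≡⟨ opposite-involutive (lookup v y) ⟩
  lookup v y                       ∎)
  where open ≡-Reasoning

-- Closed labelings of connected graphs

inN⇒adj : ∀ {n} (G : Graph n) {x w} → InN[ G ] x w → w ≢ x → Adj G x w
inN⇒adj G (inj₁ w≡x) w≢x = contradiction w≡x w≢x
inN⇒adj G (inj₂ xw) _ = xw

module Labeling {n : ℕ} (σ : Fin n → Fin n) where

  Rising : Bool → Fin n → Fin n → Set
  Rising true  x y = σ x < σ y
  Rising false x y = σ y < σ x

  rising-flip : ∀ d {x y} → Rising d x y → Rising (not d) y x
  rising-flip true  r = r
  rising-flip false r = r

  rising-trans : ∀ d {x y z} → Rising d x y → Rising d y z → Rising d x z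
  rising-trans true  r s = <-trans r s
  rising-trans false r s = <-trans s r

  rising-≢ : ∀ d {x y} → Rising d x y → x ≢ y
  rising-≢ true  r refl = <-irrefl refl r
  rising-≢ false r refl = <-irrefl refl r

  rising-asym : ∀ d {x y} → Rising d x y → Rising d y x → ⊥
  rising-asym d r s = rising-≢ d (rising-trans d r s) refl

  rising-unique : ∀ d e {x y} → Rising d x y → Rising e x y → d ≡ e
  rising-unique true  true  _ _ = refl
  rising-unique false false _ _ = refl
  rising-unique true  false r s = ⊥-elim (<-asym r s)
  rising-unique false true  r s = ⊥-elim (<-asym r s)

  module _ (σ-injective : ∀ x y → σ x ≡ σ y → x ≡ y) where

    rising-total : ∀ d {x y} → x ≢ y → Rising d x y ⊎ Rising d y x
    rising-total d {x} {y} x≢y with <-cmp (σ x) (σ y) | d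
    ... | tri< lt _ _ | true  = inj₁ lt
    ... | tri< lt _ _ | false = inj₂ lt
    ... | tri≈ _ eq _ | _     = contradiction (σ-injective x y eq) x≢y
    ... | tri> _ _ gt | true  = inj₂ gt
    ... | tri> _ _ gt | false = inj₁ gt

    orientation : ∀ {x y} → x ≢ y → ∃[ d ] Rising d x y
    orientation x≢y with rising-total true x≢y
    ... | inj₁ r = true , r
    ... | inj₂ r = false , r

module ClosedLabeling {n : ℕ} (G : Graph n) {σ : Fin n → Fin n}
    (σ-injective : ∀ x y → σ x ≡ σ y → x ≡ y) (closed : IsClosedLabeling G σ) where

  open Labeling σ public

  adj-≢ : ∀ {x y} → Adj G x y → x ≢ y
  adj-≢ e refl = Graph.irrefl G e

  closed-valley : ∀ d {x m y} → Adj G x m → Adj G m y → x ≢ y → Rising d m x → Rising d m y →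
                  Adj G x y
  closed-valley true  xm my x≢y m↗x m↗y = closed _ _ _ xm my x≢y (inj₁ (m↗x , m↗y))
  closed-valley false xm my x≢y m↗x m↗y = closed _ _ _ xm my x≢y (inj₂ (m↗x , m↗y))

  data Ascent (d : Bool) : Fin n → Fin n → Set where
    []   : ∀ {x} → Ascent d x x
    rise : ∀ {x w y} → Adj G x w → Rising d x w → Ascent d w y → Ascent d x y

  -- If the edge x w goes against the ascent, w lies below both x and its successor m, so
  -- closedness at w gives the shortcut x m.
  ascent-prepend : ∀ {d x w y} → Adj G x w → Ascent d w y → ∃[ e ] Ascent e x y
  ascent-prepend xw [] with orientation σ-injective (adj-≢ xw)
  ... | e , x↗w = e , rise xw x↗w []
  ascent-prepend {d} {x} xw t@(rise {w = m} wm w↗m rest) with rising-total σ-injective d (adj-≢ xw)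
  ... | inj₁ x↗w = d , rise xw x↗w t
  ... | inj₂ w↗x with x ≟ m
  ...   | yes refl = d , rest
  ...   | no x≢m = ascent-prepend (closed-valley d xw wm x≢m w↗x w↗m) rest

  monotone-walk : ∀ {x y} → Walk G x y → ∃[ d ] Ascent d x y
  monotone-walk here = true , []
  monotone-walk (step e w) = ascent-prepend e (proj₂ (monotone-walk w))

  ascent-rising : ∀ {d x y} → Ascent d x y → x ≡ y ⊎ Rising d x y
  ascent-rising [] = inj₁ refl
  ascent-rising {d} (rise _ r t) with ascent-rising t
  ... | inj₁ refl = inj₂ r
  ... | inj₂ s = inj₂ (rising-trans d r s)

  adj-below-ascent : ∀ {d a b c} → Ascent d b c → Adj G a c → Rising d a b → Adj G a b
  adj-below-ascent [] ac _ = ac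
  adj-below-ascent {d} (rise bm b↗m t) ac a↗b =
    closed-valley (not d) (adj-below-ascent t ac a↗m) (Graph.sym G bm) (rising-≢ d a↗b)
      (rising-flip d a↗m) (rising-flip d b↗m)
    where a↗m = rising-trans d a↗b b↗m

  induced-path-rising : ∀ {u m v} → Adj G u m → Adj G m v → ¬ Adj G u v → u ≢ v →
                        ∃[ d ] Rising d u m × Rising d m v
  induced-path-rising um mv u≁v u≢v with orientation σ-injective (adj-≢ um)
  ... | d , u↗m with rising-total σ-injective d (adj-≢ mv)
  ...   | inj₁ m↗v = d , u↗m , m↗v
  ...   | inj₂ v↗m =
    contradiction (closed-valley (not d) um mv u≢v (rising-flip d u↗m) (rising-flip d v↗m)) u≁v

  induced-path-monotone : ∀ d {u m v} → Adj G u m → Adj G m v → ¬ Adj G u v → u ≢ v →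
                          Rising d u m ⊎ Rising d m v ⊎ Rising d u v → Rising d u m × Rising d m v
  induced-path-monotone d um mv u≁v u≢v known with induced-path-rising um mv u≁v u≢v
  ... | e , u↗m , m↗v = subst (λ e → Rising e _ _ × Rising e _ _) (agrees known) (u↗m , m↗v)
    where
    agrees : Rising d _ _ ⊎ Rising d _ _ ⊎ Rising d _ _ → e ≡ d
    agrees (inj₁ u↗m′) = rising-unique e d u↗m u↗m′
    agrees (inj₂ (inj₁ m↗v′)) = rising-unique e d m↗v m↗v′
    agrees (inj₂ (inj₂ u↗v′)) = rising-unique e d (rising-trans e u↗m m↗v) u↗v′

  module _ (connected : Connected G) where

    ascent-toward : ∀ d {x y} → Rising d x y → Ascent d x y
    ascent-toward d {x} {y} r with monotone-walk (connected x y)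
    ... | e , t with ascent-rising t
    ...   | inj₁ refl = contradiction refl (rising-≢ d r)
    ...   | inj₂ r′ = subst (λ e → Ascent e x y) (rising-unique e d r′ r) t

    umbrella : ∀ d {a b c} → Rising d a b → Rising d b c → Adj G a c → Adj G a b × Adj G b c
    umbrella d a↗b b↗c ac =
      adj-below-ascent (ascent-toward d b↗c) ac a↗b ,
      Graph.sym G (adj-below-ascent (ascent-toward (not d) (rising-flip d a↗b)) (Graph.sym G ac)
                     (rising-flip d b↗c))

    rising-transportˡ : ∀ d {p x y} → Adj G p x → ¬ Adj G p y → x ≢ y →
                        Rising d p y → Rising d x y
    rising-transportˡ d px p≁y x≢y p↗y with rising-total σ-injective d x≢y
    ... | inj₁ x↗y = x↗y
    ... | inj₂ y↗x = contradiction (proj₁ (umbrella d p↗y y↗x px)) p≁y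

    rising-transportʳ : ∀ d {x y y′} → Adj G y y′ → ¬ Adj G x y → x ≢ y′ →
                        Rising d x y → Rising d x y′
    rising-transportʳ d yy′ x≁y x≢y′ x↗y with rising-total σ-injective d x≢y′
    ... | inj₁ x↗y′ = x↗y′
    ... | inj₂ y′↗x = contradiction (proj₂ (umbrella d y′↗x x↗y (Graph.sym G yy′))) x≁y

-- The quotient graph

module Classes {n r : ℕ} (G : Graph n) (cls : Fin n → Fin r)
    (exch : ∀ i j → (cls i ≡ cls j) ⇔ Exch G i j) where

  private
    H = quotient G cls

  class-neighbour : ∀ {u u′ w} → cls u ≡ cls u′ → InN[ G ] u′ w → u ≢ w → Adj G u w
  class-neighbour {u} {u′} {w} eq w∈N[u′] u≢w =
    inN⇒adj G (Equivalence.from (Equivalence.to (exch u u′) eq w) w∈N[u′]) (u≢w ∘ sym)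

  same-class-adj : ∀ {u v} → cls u ≡ cls v → u ≢ v → Adj G u v
  same-class-adj eq = class-neighbour eq (inj₁ refl)

  class-adj : ∀ {u v u′ v′} → cls u ≡ cls u′ → cls v ≡ cls v′ → cls u ≢ cls v →
              Adj G u′ v′ → Adj G u v
  class-adj {u} cu cv cu≢cv u′v′ =
    Graph.sym G (class-neighbour cv (inj₂ (Graph.sym G (class-neighbour cu (inj₂ u′v′) u≢v′)))
                  λ { refl → cu≢cv refl })
    where
    u≢v′ : u ≢ _
    u≢v′ refl = cu≢cv (sym cv)

  adj-quotient⁻ : ∀ {u v} → Adj H (cls u) (cls v) → Adj G u v
  adj-quotient⁻ (cu≢cv , _ , _ , cu′ , cv′ , e) = class-adj (sym cu′) (sym cv′) cu≢cv e

  inN-quotient⁺ : ∀ {i x} → InN[ G ] i x → InN[ H ] (cls i) (cls x)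
  inN-quotient⁺ (inj₁ refl) = inj₁ refl
  inN-quotient⁺ {i} {x} (inj₂ ix) with cls x ≟ cls i
  ... | yes eq = inj₁ eq
  ... | no ne = inj₂ (ne ∘ sym , i , x , refl , refl , ix)

  inN-quotient⁻ : ∀ {j x} → InN[ H ] (cls j) (cls x) → InN[ G ] j x
  inN-quotient⁻ {j} {x} (inj₁ eq) with x ≟ j
  ... | yes x≡j = inj₁ x≡j
  ... | no x≢j = inj₂ (same-class-adj (sym eq) (x≢j ∘ sym))
  inN-quotient⁻ (inj₂ e) = inj₂ (adj-quotient⁻ e)

  quotient-collapsed : (∀ a → ∃[ i ] cls i ≡ a) → Collapsed H
  quotient-collapsed surjective a b ex with surjective a | surjective b
  ... | i , refl | j , refl = Equivalence.from (exch i j) λ x →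
    mk⇔ (inN-quotient⁻ ∘ Equivalence.to (ex (cls x)) ∘ inN-quotient⁺)
        (inN-quotient⁻ ∘ Equivalence.from (ex (cls x)) ∘ inN-quotient⁺)

  quotient-walk : ∀ {i j} → Walk G i j → Walk H (cls i) (cls j)
  quotient-walk here = here
  quotient-walk {i} {j} (step {w = w} e t) with cls i ≟ cls w
  ... | yes eq = subst (λ a → Walk H a (cls j)) (sym eq) (quotient-walk t)
  ... | no ne = step (ne , i , w , refl , refl , e) (quotient-walk t)

  quotient-connected : (∀ a → ∃[ i ] cls i ≡ a) → Connected G → Connected H
  quotient-connected surjective connected a b with surjective a | surjective b
  ... | i , refl | j , refl = quotient-walk (connected i j)

  quotient-closed : (∀ i j → cls i < cls j → i < j) → IsClosedLabeling G id → IsClosedLabeling H id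
  quotient-closed ord closed a b c (a≢b , i , j , refl , refl , ij) (_ , j′ , k , cj′ , refl , j′k)
                  a≢c extreme =
    a≢c , i , k , refl , refl , closed i j′ k ij′ j′k (λ { refl → a≢c refl }) (lift extreme)
    where
    ij′ : Adj G i j′
    ij′ = class-adj refl cj′ (λ eq → a≢b (trans eq cj′)) ij
    ord′ : ∀ {u v} → cls u < cls v → u < v
    ord′ = ord _ _
    lift : (cls j < cls i × cls j < cls k) ⊎ (cls i < cls j × cls k < cls j) →
           (j′ < i × j′ < k) ⊎ (i < j′ × k < j′)
    lift (inj₁ (ba , bc)) =
      inj₁ (ord′ (subst (_< cls i) (sym cj′) ba) , ord′ (subst (_< cls k) (sym cj′) bc))
    lift (inj₂ (ab , cb)) =
      inj₂ (ord′ (subst (cls i <_) (sym cj′) ab) , ord′ (subst (cls k <_) (sym cj′) cb))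

-- Closed labelings are monotone or antitone from class to class

module Classification {n r : ℕ} (G : Graph n) (closed-id : IsClosedLabeling G id)
    (cls : Fin n → Fin r)
    (exch : ∀ i j → (cls i ≡ cls j) ⇔ Exch G i j)
    (ord : ∀ i j → cls i < cls j → i < j) where

  open Classes G cls exch using (class-neighbour)
  module Ord = ClosedLabeling G (λ _ _ → id) closed-id

  module _ {σ : Fin n → Fin n} (s : Bool)
      (block-rising : ∀ i j → cls i < cls j → Labeling.Rising σ s i j) where
    open Labeling σ

    cross-class-order : ∀ {u v} → cls u ≢ cls v → Rising s u v → u < v
    cross-class-order {u} {v} cu≢cv u↗v with <-cmp (cls u) (cls v)
    ... | tri< cu<cv _ _ = ord u v cu<cv
    ... | tri≈ _ cu≡cv _ = contradiction cu≡cv cu≢cv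
    ... | tri> _ _ cv<cu = ⊥-elim (rising-asym s u↗v (block-rising v u cv<cu))

    cross-class-valley : ∀ d {j i k} → cls j ≢ cls i → cls k ≢ cls i → Adj G j i → Adj G i k → j ≢ k →
                         Rising d i j → Rising d i k → Adj G j k
    cross-class-valley d cj≢ci ck≢ci ji ik j≢k i↗j i↗k with d Bool.≟ s
    ... | yes refl = Ord.closed-valley true ji ik j≢k
                       (cross-class-order (cj≢ci ∘ sym) i↗j) (cross-class-order (ck≢ci ∘ sym) i↗k)
    ... | no d≢s = Ord.closed-valley false ji ik j≢k
                     (cross-class-order cj≢ci (downhill i↗j)) (cross-class-order ck≢ci (downhill i↗k))
      where
      downhill : ∀ {i x} → Rising d i x → Rising s x i
      downhill = subst (λ e → Rising e _ _) (sym (Bool.¬-not (d≢s ∘ sym))) ∘ rising-flip d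

    block-rising⇒closed : IsClosedLabeling G σ
    block-rising⇒closed j i k ji ik j≢k extreme with cls j ≟ cls i | cls k ≟ cls i | extreme
    ... | yes cj≡ci | _ | _ = class-neighbour cj≡ci (inj₂ ik) j≢k
    ... | no _ | yes ck≡ci | _ =
      Graph.sym G (class-neighbour ck≡ci (inj₂ (Graph.sym G ji)) (j≢k ∘ sym))
    ... | no cj≢ci | no ck≢ci | inj₁ (i↗j , i↗k) =
      cross-class-valley true cj≢ci ck≢ci ji ik j≢k i↗j i↗k
    ... | no cj≢ci | no ck≢ci | inj₂ (j↘i , k↘i) =
      cross-class-valley false cj≢ci ck≢ci ji ik j≢k j↘i k↘i

  module _ (connected : Connected G) (adj? : ∀ u v → Dec (Adj G u v)) where

    inN? : ∀ x w → Dec (InN[ G ] x w)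
    inN? x w = (w ≟ x) ⊎-dec adj? x w

    Separates : Fin n → Fin n → Fin n → Set
    Separates x y w = InN[ G ] x w × ¬ InN[ G ] y w

    ⊆-or-separated : ∀ x y → (∀ w → InN[ G ] x w → InN[ G ] y w) ⊎ ∃[ w ] Separates x y w
    ⊆-or-separated x y with all? (λ w → inN? x w →-dec inN? y w)
    ... | yes x⊆y = inj₁ x⊆y
    ... | no x⊈y with ¬∀⟶∃¬ n _ (λ w → inN? x w →-dec inN? y w) x⊈y
    ...   | w , ¬x⊆y with inN? x w
    ...     | yes w∈x = inj₂ (w , w∈x , λ w∈y → ¬x⊆y λ _ → w∈y)
    ...     | no w∉x = ⊥-elim (¬x⊆y λ w∈x → contradiction w∈x w∉x)

    separating-vertex : ∀ {x y} → cls x ≢ cls y → ∃[ w ] (Separates x y w ⊎ Separates y x w)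
    separating-vertex {x} {y} cx≢cy with ⊆-or-separated x y | ⊆-or-separated y x
    ... | inj₂ (w , sep) | _ = w , inj₁ sep
    ... | inj₁ _ | inj₂ (w , sep) = w , inj₂ sep
    ... | inj₁ x⊆y | inj₁ y⊆x =
      contradiction (Equivalence.from (exch x y) λ w → mk⇔ (x⊆y w) (y⊆x w)) cx≢cy

    NonEdge : Fin n → Fin n → Set
    NonEdge x y = x < y × ¬ Adj G x y

    nonEdge-between : ∀ {u v} → ¬ InN[ G ] u v → ∃₂ NonEdge
    nonEdge-between {u} {v} v∉N[u] with <-cmp u v
    ... | tri< u<v _ _ = u , v , u<v , v∉N[u] ∘ inj₂
    ... | tri≈ _ refl _ = contradiction (inj₁ refl) v∉N[u]
    ... | tri> _ _ v<u = v , u , v<u , v∉N[u] ∘ inj₂ ∘ Graph.sym G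

    nonEdge-exists : ∀ {i j} → cls i ≢ cls j → ∃₂ NonEdge
    nonEdge-exists ci≢cj with separating-vertex ci≢cj
    ... | _ , inj₁ (_ , w∉N[j]) = nonEdge-between w∉N[j]
    ... | _ , inj₂ (_ , w∉N[i]) = nonEdge-between w∉N[i]

    ascending-walk : ∀ {x y} → x ≤ y → Ord.Ascent true x y
    ascending-walk {x} {y} x≤y with x ≟ y
    ... | yes refl = Ord.[]
    ... | no x≢y = Ord.ascent-toward connected true (≤∧≢⇒< x≤y x≢y)

    module _ {σ : Fin n → Fin n} (σ-injective : ∀ x y → σ x ≡ σ y → x ≡ y)
        (σ-closed : IsClosedLabeling G σ) where

      open ClosedLabeling G σ-injective σ-closed
        using (Rising; orientation; rising-transportˡ; rising-transportʳ)
        renaming (induced-path-monotone to σ-induced-path-monotone)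

      nonEdge-stepˡ : ∀ s {p w y} → Adj G p w → p < w → NonEdge w y →
                      NonEdge p y × (Rising s w y ⇔ Rising s p y)
      nonEdge-stepˡ s pw p<w (w<y , w≁y) = (p<y , p≁y) ,
        mk⇔ (rising-transportˡ connected s (Graph.sym G pw) w≁y (<⇒≢ p<y))
            (rising-transportˡ connected s pw p≁y (<⇒≢ w<y))
        where
        p<y = <-trans p<w w<y
        p≁y : ¬ Adj G _ _
        p≁y py = w≁y (proj₂ (Ord.umbrella connected true p<w w<y py))

      nonEdge-stepʳ : ∀ s {x y w} → Adj G y w → y < w → NonEdge x y →
                      NonEdge x w × (Rising s x y ⇔ Rising s x w)
      nonEdge-stepʳ s yw y<w (x<y , x≁y) = (x<w , x≁w) ,
        mk⇔ (rising-transportʳ connected s yw x≁y (<⇒≢ x<w))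
            (rising-transportʳ connected s (Graph.sym G yw) x≁w (<⇒≢ x<y))
        where
        x<w = <-trans x<y y<w
        x≁w : ¬ Adj G _ _
        x≁w xw = x≁y (proj₁ (Ord.umbrella connected true x<y y<w xw))

      nonEdge-lower : ∀ s {p x y} → Ord.Ascent true p x → NonEdge x y →
                      NonEdge p y × (Rising s x y ⇔ Rising s p y)
      nonEdge-lower s Ord.[] ne = ne , ⇔.refl
      nonEdge-lower s (Ord.rise pw p<w w⇝x) ne =
        let ne′ , xy~wy = nonEdge-lower s w⇝x ne
            ne″ , wy~py = nonEdge-stepˡ s pw p<w ne′
        in ne″ , ⇔.trans xy~wy wy~py

      nonEdge-raise : ∀ s {x y q} → Ord.Ascent true y q → NonEdge x y →
                      NonEdge x q × (Rising s x y ⇔ Rising s x q)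
      nonEdge-raise s Ord.[] ne = ne , ⇔.refl
      nonEdge-raise s (Ord.rise yw y<w w⇝q) ne =
        let ne′ , xy~xw = nonEdge-stepʳ s yw y<w ne
            ne″ , xw~xq = nonEdge-raise s w⇝q ne′
        in ne″ , ⇔.trans xy~xw xw~xq

      nonEdge-widen : ∀ s {p x y q} → p ≤ x → y ≤ q → NonEdge x y →
                      NonEdge p q × (Rising s x y ⇔ Rising s p q)
      nonEdge-widen s p≤x y≤q ne =
        let ne′ , xy~py = nonEdge-lower s (ascending-walk p≤x) ne
            ne″ , py~pq = nonEdge-raise s (ascending-walk y≤q) ne′
        in ne″ , ⇔.trans xy~py py~pq

      nonEdges-aligned : ∀ s {x y x′ y′} → NonEdge x y → NonEdge x′ y′ → Rising s x y → Rising s x′ y′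
      nonEdges-aligned s {x} {y} {x′} {y′} ne ne′ x↗y with lower-bound x x′ | upper-bound y y′
      ... | p , p≤x , p≤x′ | q , y≤q , y′≤q =
        Equivalence.from (proj₂ (nonEdge-widen s p≤x′ y′≤q ne′))
          (Equivalence.to (proj₂ (nonEdge-widen s p≤x y≤q ne)) x↗y)

      NonEdgesRise : Bool → Set
      NonEdgesRise s = ∀ {x y} → NonEdge x y → Rising s x y

      -- A separating vertex w forms with x and y an induced path whose ends are a non-edge;
      -- both labelings are monotone along it.
      crossEdge-rising : ∀ s → NonEdgesRise s →
                         ∀ {x y} → x < y → Adj G x y → cls x ≢ cls y → Rising s x y
      crossEdge-rising s rises {x} {y} x<y xy cx≢cy with separating-vertex cx≢cy
      ... | w , inj₁ (w∈N[x] , w∉N[y]) =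
        proj₂ (σ-induced-path-monotone s wx xy w≁y w≢y (inj₂ (inj₂ (rises (w<y , w≁y)))))
        where
        wx : Adj G w x
        wx = Graph.sym G (inN⇒adj G w∈N[x] λ { refl → w∉N[y] (inj₂ (Graph.sym G xy)) })
        w≁y = w∉N[y] ∘ inj₂ ∘ Graph.sym G
        w≢y = w∉N[y] ∘ inj₁
        w<y = <-trans (proj₁ (Ord.induced-path-monotone true wx xy w≁y w≢y (inj₂ (inj₁ x<y)))) x<y
      ... | w , inj₂ (w∈N[y] , w∉N[x]) =
        proj₁ (σ-induced-path-monotone s xy yw x≁w x≢w (inj₂ (inj₂ (rises (x<w , x≁w)))))
        where
        yw : Adj G y w
        yw = inN⇒adj G w∈N[y] λ { refl → w∉N[x] (inj₂ xy) }
        x≁w = w∉N[x] ∘ inj₂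
        x≢w = w∉N[x] ∘ inj₁ ∘ sym
        x<w = <-trans x<y (proj₂ (Ord.induced-path-monotone true xy yw x≁w x≢w (inj₁ x<y)))

      crossClass-rising : ∀ s → NonEdgesRise s → ∀ u v → cls u < cls v → Rising s u v
      crossClass-rising s rises u v cu<cv with adj? u v
      ... | yes uv = crossEdge-rising s rises (ord u v cu<cv) uv (<⇒≢ cu<cv)
      ... | no u≁v = rises (ord u v cu<cv , u≁v)

      closed⇒block-rising : ∀ {i j} → cls i ≢ cls j → ∃[ s ] (∀ u v → cls u < cls v → Rising s u v)
      closed⇒block-rising ci≢cj with nonEdge-exists ci≢cj
      ... | x , y , ne with orientation σ-injective (<⇒≢ (proj₁ ne))
      ...   | s , x↗y = s , crossClass-rising s λ ne′ → nonEdges-aligned s ne ne′ x↗y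

-- Class-preserving permutations

module Arrangements {n r : ℕ} (cls : Fin n → Fin r) where

  open import Data.Vec.Membership.DecPropositional (_≟_ {n}) using () renaming (_∈?_ to _∈ᵛ?_)

  class : Fin r → List (Fin n)
  class c = filter (λ i → cls i ≟ c) (List.allFin n)

  classCount : Fin r → List (Fin n) → ℕ
  classCount c = length ∘ filter (λ i → cls i ≟ c)

  SameClass : Fin n → Fin n → Set
  SameClass x y = cls y ≡ cls x

  Arrangement : ∀ {m} → Vec (Fin n) m → Vec (Fin n) m → Set
  Arrangement xs ys = Pointwise SameClass xs ys × Uniqueᵛ ys

  fresh : ∀ {m} → Fin n → Vec (Fin n) m → List (Fin n)
  fresh x ys = filter (λ y → ¬? (y ∈ᵛ? ys)) (class (cls x))

  arrangements : ∀ {m} → Vec (Fin n) m → List (Vec (Fin n) m)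
  arrangements [] = [ [] ]
  arrangements (x ∷ xs) = extensions (fresh x) (arrangements xs)

  class-unique : ∀ c → Unique (class c)
  class-unique c = Unique.filter⁺ (λ i → cls i ≟ c) (Unique.allFin⁺ n)

  ∈-fresh⁻ : ∀ {m x y} {ys : Vec (Fin n) m} → y ∈ fresh x ys → SameClass x y × y ∉ᵛ ys
  ∈-fresh⁻ {x = x} y∈fresh =
    let y∈class , y∉ys = ∈-filter⁻ (λ y → ¬? (y ∈ᵛ? _)) {xs = class (cls x)} y∈fresh
    in proj₂ (∈-filter⁻ (λ i → cls i ≟ cls x) {xs = List.allFin n} y∈class) , y∉ys

  ∈-fresh⁺ : ∀ {m x y} {ys : Vec (Fin n) m} → SameClass x y → y ∉ᵛ ys → y ∈ fresh x ys
  ∈-fresh⁺ {x = x} {y} same y∉ys =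
    ∈-filter⁺ (λ y → ¬? (y ∈ᵛ? _)) (∈-filter⁺ (λ i → cls i ≟ cls x) (∈-allFin y) same) y∉ys

  ∈-arrangements⁻ : ∀ {m} (xs ys : Vec (Fin n) m) → ys ∈ arrangements xs → Arrangement xs ys
  ∈-arrangements⁻ [] [] _ = [] , []
  ∈-arrangements⁻ (x ∷ xs) (y ∷ ys) y∷ys∈ =
    let ys∈ , y∈fresh = ∈-extensions⁻ (fresh x) (arrangements xs) y∷ys∈
        pointwise , unique = ∈-arrangements⁻ xs ys ys∈
        same , y∉ys = ∈-fresh⁻ y∈fresh
    in same ∷ pointwise , ∉⇒All≢ y∉ys ∷ unique

  ∈-arrangements⁺ : ∀ {m} {xs ys : Vec (Fin n) m} → Arrangement xs ys → ys ∈ arrangements xs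
  ∈-arrangements⁺ ([] , []) = here refl
  ∈-arrangements⁺ {xs = x ∷ _} (same ∷ pointwise , y≢ys ∷ unique) =
    ∈-extensions⁺ (fresh x) (∈-arrangements⁺ (pointwise , unique)) (∈-fresh⁺ same (All≢⇒∉ y≢ys))

  arrangements-unique : ∀ {m} (xs : Vec (Fin n) m) → Unique (arrangements xs)
  arrangements-unique [] = [] ∷ []
  arrangements-unique (x ∷ xs) = extensions-unique (fresh x) (arrangements-unique xs)
    λ ys → Unique.filter⁺ (λ y → ¬? (y ∈ᵛ? ys)) (class-unique (cls x))

  classCount-∷-same : ∀ x l → classCount (cls x) (x ∷ l) ≡ suc (classCount (cls x) l)
  classCount-∷-same x l = cong length (filter-accept (λ i → cls i ≟ cls x) refl)

  classCount-∷-other : ∀ {x c} l → cls x ≢ c → classCount c (x ∷ l) ≡ classCount c l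
  classCount-∷-other l cx≢c = cong length (filter-reject (λ i → cls i ≟ _) cx≢c)

  classCount-pointwise : ∀ c {m} {xs ys : Vec (Fin n) m} → Pointwise SameClass xs ys →
                         classCount c (toList ys) ≡ classCount c (toList xs)
  classCount-pointwise c [] = refl
  classCount-pointwise c (_∷_ {x = x} {y = y} same pointwise) with cls y ≟ c | cls x ≟ c
  ... | yes _    | yes _    = cong suc (classCount-pointwise c pointwise)
  ... | no _     | no _     = classCount-pointwise c pointwise
  ... | yes cy≡c | no cx≢c  = contradiction (trans (sym same) cy≡c) cx≢c
  ... | no cy≢c  | yes cx≡c = contradiction (trans same cx≡c) cy≢c

  length-class∩ : ∀ c {m} {ys : Vec (Fin n) m} → Uniqueᵛ ys →
                  length (filter (_∈ᵛ? ys) (class c)) ≡ classCount c (toList ys)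
  length-class∩ c {ys = ys} unique =
    unique-⊆⊇⇒length≡ _≟_ (Unique.filter⁺ (_∈ᵛ? ys) (class-unique c))
      (Unique.filter⁺ (λ i → cls i ≟ c) (toList-unique unique)) class∩ys⊆ ⊆class∩ys
    where
    class∩ys⊆ : filter (_∈ᵛ? ys) (class c) ⊆ filter (λ i → cls i ≟ c) (toList ys)
    class∩ys⊆ z∈ with ∈-filter⁻ (_∈ᵛ? ys) {xs = class c} z∈
    ... | z∈class , z∈ys = ∈-filter⁺ (λ i → cls i ≟ c) (∈-toList⁺ z∈ys)
                             (proj₂ (∈-filter⁻ (λ i → cls i ≟ c) {xs = List.allFin n} z∈class))
    ⊆class∩ys : filter (λ i → cls i ≟ c) (toList ys) ⊆ filter (_∈ᵛ? ys) (class c)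
    ⊆class∩ys {z} z∈ with ∈-filter⁻ (λ i → cls i ≟ c) {xs = toList ys} z∈
    ... | z∈ys , cz≡c =
      ∈-filter⁺ (_∈ᵛ? ys) (∈-filter⁺ (λ i → cls i ≟ c) (∈-allFin z) cz≡c) (∈-toList⁻ z∈ys)

  length-fresh : ∀ x {m} {xs ys : Vec (Fin n) m} → Arrangement xs ys →
                 length (fresh x ys) ≡ classSize cls (cls x) ∸ classCount (cls x) (toList xs)
  length-fresh x {xs = xs} {ys} (pointwise , unique) = begin
    length (fresh x ys)                             ≡⟨ ℕₚ.m+n∸m≡n (length used) _ ⟨
    length used + length (fresh x ys) ∸ length used
      ≡⟨ cong₂ _∸_ (length-filter-partition (_∈ᵛ? ys) (class (cls x)))
                   (trans (length-class∩ (cls x) unique) (classCount-pointwise (cls x) pointwise)) ⟩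
    classSize cls (cls x) ∸ classCount (cls x) (toList xs) ∎
    where
    open ≡-Reasoning
    used = filter (_∈ᵛ? ys) (class (cls x))

  length-arrangements : ∀ {m} (xs : Vec (Fin n) m) →
    length (arrangements xs) ≡ product (tabulate λ c → classSize cls c P′ classCount c (toList xs))
  length-arrangements [] = sym (product-ones r)
    where
    product-ones : ∀ k → product (tabulate {n = k} λ _ → 1) ≡ 1
    product-ones zero = refl
    product-ones (suc k) = trans (ℕₚ.+-identityʳ _) (product-ones k)
  length-arrangements (x ∷ xs) = begin
    length (extensions (fresh x) (arrangements xs))
      ≡⟨ length-extensions (fresh x) (arrangements xs) k
           (λ {ys} → length-fresh x {xs = xs} ∘ ∈-arrangements⁻ xs ys) ⟩
    length (arrangements xs) * k        ≡⟨ cong (_* k) (length-arrangements xs) ⟩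
    product (tabulate before) * k       ≡⟨ ℕₚ.*-comm _ k ⟩
    k * product (tabulate before)
      ≡⟨ product-tabulate-update after before (cls x) {k}
           (cong (classSize cls (cls x) P′_) (classCount-∷-same x (toList xs)))
           (λ c c≢cx → cong (classSize cls c P′_) (classCount-∷-other (toList xs) (c≢cx ∘ sym))) ⟨
    product (tabulate after)            ∎
    where
    open ≡-Reasoning
    k = classSize cls (cls x) ∸ classCount (cls x) (toList xs)
    before after : Fin r → ℕ
    before c = classSize cls c P′ classCount c (toList xs)
    after c = classSize cls c P′ classCount c (toList (x ∷ xs))

  length-arrangements-allFin : length (arrangements (Vec.allFin n)) ≡ prodFact cls
  length-arrangements-allFin = begin
    length (arrangements (Vec.allFin n))
      ≡⟨ length-arrangements (Vec.allFin n) ⟩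
    product (tabulate λ c → classSize cls c P′ classCount c (toList (Vec.allFin n)))
      ≡⟨ cong product (tabulate-cong λ c →
           trans (cong (λ l → classSize cls c P′ classCount c l) (toList-tabulate id))
                 (nP′n≡n! (classSize cls c))) ⟩
    product (tabulate λ c → classSize cls c !)
      ≡⟨ cong product (map-tabulate id (λ c → classSize cls c !)) ⟨
    prodFact cls ∎
    where open ≡-Reasoning

  arrangement-allFin⁻ : ∀ {ys} → Arrangement (Vec.allFin n) ys →
    (∀ i → cls (lookup ys i) ≡ cls i) × (∀ i j → lookup ys i ≡ lookup ys j → i ≡ j)
  arrangement-allFin⁻ (pointwise , unique) =
    (λ i → trans (Pointwise.lookup pointwise i) (cong cls (lookup-allFin i))) ,
    Uniqueᵛ.lookup-injective unique

  arrangement-allFin⁺ : ∀ {ys} → (∀ i → cls (lookup ys i) ≡ cls i) →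
    (∀ i j → lookup ys i ≡ lookup ys j → i ≡ j) → Arrangement (Vec.allFin n) ys
  arrangement-allFin⁺ {ys} preserves injective =
    subst (Pointwise SameClass (Vec.allFin n)) (tabulate∘lookup ys) (Pointwise.tabulate⁺ preserves) ,
    subst Uniqueᵛ (tabulate∘lookup ys) (Uniqueᵛ.tabulate⁺ (injective _ _))

module _ {n r : ℕ} {cls : Fin n → Fin r} (ord : ∀ i j → cls i < cls j → i < j) where

  cls-monotone : ∀ {i j} → i ≤ j → cls i ≤ cls j
  cls-monotone {i} {j} i≤j with <-cmp (cls i) (cls j)
  ... | tri< ci<cj _ _ = ℕₚ.<⇒≤ ci<cj
  ... | tri≈ _ ci≡cj _ = ≤-reflexive ci≡cj
  ... | tri> _ _ cj<ci = contradiction i≤j (ℕₚ.<⇒≱ (ord j i cj<ci))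

  -- Otherwise σ would map the vertices in the classes up to cls (σ p) (resp. from cls (σ p) on)
  -- injectively into themselves and also send p, which lies outside them, there.
  block-monotone⇒class-preserving : ∀ {σ : Fin n → Fin n} → (∀ x y → σ x ≡ σ y → x ≡ y) →
    (∀ i j → cls i < cls j → σ i < σ j) → ∀ p → cls (σ p) ≡ cls p
  block-monotone⇒class-preserving {σ} σ-injective monotone p with <-cmp (cls (σ p)) (cls p)
  ... | tri≈ _ same _ = same
  ... | tri< b<a _ _ = contradiction
        (injective-reflects σ-injective (λ q → cls q ≤? cls (σ p))
          (λ q cq≤b → cls-monotone (ℕₚ.<⇒≤ (monotone q p (ℕₚ.≤-<-trans cq≤b b<a)))) p ≤-refl)
        (ℕₚ.<⇒≱ b<a)
  ... | tri> _ _ a<b = contradiction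
        (injective-reflects σ-injective (λ q → cls (σ p) ≤? cls q)
          (λ q b≤cq → cls-monotone (ℕₚ.<⇒≤ (monotone p q (ℕₚ.<-≤-trans a<b b≤cq)))) p ≤-refl)
        (ℕₚ.<⇒≱ a<b)

-- Counting the closed labelings

module ClosedLabelings {n r : ℕ} (G : Graph n) (cls : Fin n → Fin r)
    (connected : Connected G) (closed-id : IsClosedLabeling G id)
    (exch : ∀ i j → (cls i ≡ cls j) ⇔ Exch G i j)
    (ord : ∀ i j → cls i < cls j → i < j)
    {i₀ j₀ : Fin n} (ci₀<cj₀ : cls i₀ < cls j₀) where

  open Arrangements cls
  open Classification G closed-id cls exch ord

  BlockMonotone : Vec (Fin n) n → Set
  BlockMonotone v = ∀ i j → cls i < cls j → lookup v i < lookup v j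

  classPreserving : List (Vec (Fin n) n)
  classPreserving = arrangements (Vec.allFin n)

  closedLabelings : List (Vec (Fin n) n)
  closedLabelings = classPreserving ++ map mirror classPreserving

  classPreserving⁻ : ∀ {v} → v ∈ classPreserving →
                     (∀ x y → lookup v x ≡ lookup v y → x ≡ y) × BlockMonotone v
  classPreserving⁻ {v} v∈ =
    let preserves , injective = arrangement-allFin⁻ (∈-arrangements⁻ _ v v∈)
    in injective , λ i j ci<cj → ord _ _ (subst₂ _<_ (sym (preserves i)) (sym (preserves j)) ci<cj)

  classPreserving⁺ : ∀ {v} → (∀ x y → lookup v x ≡ lookup v y → x ≡ y) → BlockMonotone v →
                     v ∈ classPreserving
  classPreserving⁺ injective monotone =
    ∈-arrangements⁺
      (arrangement-allFin⁺ (block-monotone⇒class-preserving ord injective monotone) injective)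

  classPreserving⇒closed : ∀ {v} → v ∈ classPreserving → IsClosedLabelingVec G v
  classPreserving⇒closed v∈ =
    let injective , monotone = classPreserving⁻ v∈
    in (injective , injective⇒surjective injective) , block-rising⇒closed true monotone

  mirror-classPreserving⇒closed : ∀ {v} → v ∈ classPreserving → IsClosedLabelingVec G (mirror v)
  mirror-classPreserving⇒closed {v} v∈ =
    let injective , monotone = classPreserving⁻ v∈
        injective′ = lookup-mirror-injective v injective
    in (injective′ , injective⇒surjective injective′) ,
       block-rising⇒closed false λ i j → lookup-mirror-< v ∘ monotone i j

  closed⇒∈ : (∀ u v → Dec (Adj G u v)) → ∀ {v} → IsClosedLabelingVec G v → v ∈ closedLabelings
  closed⇒∈ adj? {v} ((injective , _) , closed)
    with closed⇒block-rising connected adj? injective closed (<⇒≢ ci₀<cj₀)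
  ... | true , monotone = ∈-++⁺ˡ (classPreserving⁺ injective monotone)
  ... | false , antitone =
    ∈-++⁺ʳ classPreserving (subst (_∈ map mirror classPreserving) (mirror-involutive v)
      (∈-map⁺ mirror (classPreserving⁺ (lookup-mirror-injective v injective)
                                       λ i j → lookup-mirror-< v ∘ antitone i j)))

  ∈-closedLabelings : ∀ v → v ∈ closedLabelings ⇔ IsClosedLabelingVec G v
  ∈-closedLabelings v = mk⇔ to from
    where
    open DecMembership (≡-dec _≟_) using (_∈?_)
    to : v ∈ closedLabelings → IsClosedLabelingVec G v
    to v∈ with ∈-++⁻ classPreserving v∈
    ... | inj₁ v∈classPreserving = classPreserving⇒closed v∈classPreserving
    ... | inj₂ v∈mirrored with ∈-map⁻ mirror v∈mirrored
    ...   | _ , w∈classPreserving , refl = mirror-classPreserving⇒closed w∈classPreserving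
    -- Adjacency need not be decidable, but membership in the list is, so deciding adjacency
    -- is only needed under a double negation.
    from : IsClosedLabelingVec G v → v ∈ closedLabelings
    from closed = decidable-stable (v ∈? closedLabelings)
                    λ v∉ → ¬¬-decidable (Adj G) λ adj? → v∉ (closed⇒∈ adj? closed)

  closedLabelings-unique : Unique closedLabelings
  closedLabelings-unique =
    Unique.++⁺ (arrangements-unique (Vec.allFin n))
               (Unique.map⁺ mirror-injective (arrangements-unique (Vec.allFin n))) disjoint
    where
    disjoint : ∀ {v} → ¬ (v ∈ classPreserving × v ∈ map mirror classPreserving)
    disjoint (v∈ , v∈mirrored) with ∈-map⁻ mirror v∈mirrored
    ... | w , w∈ , refl = <-asym (proj₂ (classPreserving⁻ v∈) i₀ j₀ ci₀<cj₀)
                                 (lookup-mirror-< w (proj₂ (classPreserving⁻ w∈) i₀ j₀ ci₀<cj₀))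

  length-closedLabelings : length closedLabelings ≡ 2 * prodFact cls
  length-closedLabelings = begin
    length (classPreserving ++ map mirror classPreserving)
      ≡⟨ length-++ classPreserving ⟩
    length classPreserving + length (map mirror classPreserving)
      ≡⟨ cong (length classPreserving +_) (length-map mirror classPreserving) ⟩
    length classPreserving + length classPreserving
      ≡⟨ cong₂ _+_ length-arrangements-allFin
                   (trans length-arrangements-allFin (sym (ℕₚ.+-identityʳ _))) ⟩
    2 * prodFact cls ∎
    where open ≡-Reasoning

  hasExactly : HasExactly G (2 * prodFact cls)
  hasExactly = closedLabelings , closedLabelings-unique , ∈-closedLabelings , length-closedLabelings

two-classes : ∀ {n r} {cls : Fin n → Fin r} → (∀ a → ∃[ i ] cls i ≡ a) → 1 ℕ.< r →
              ∃₂ λ i j → cls i < cls j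
two-classes {r = suc zero} _ (s≤s ())
two-classes {r = suc (suc _)} surjective _ with surjective zero | surjective (suc zero)
... | i , ci≡0 | j , cj≡1 = i , j , subst₂ _<_ (sym ci≡0) (sym cj≡1) (s≤s z≤n)

theorem4p3 : ∀ {n r} (G : Graph n) (cls : Fin n → Fin r) →
    Connected G →
    IsClosedLabeling G id →
    (∀ a → ∃[ i ] cls i ≡ a) →
    (∀ i j → (cls i ≡ cls j) ⇔ Exch G i j) →
    (∀ i j → cls i < cls j → i < j) →
    (Connected (quotient G cls) × Collapsed (quotient G cls) × IsClosedLabeling (quotient G cls) id)
    × (1 Data.Nat.< r → HasExactly G (2 * prodFact cls))
theorem4p3 G cls connected closed-id surjective exch ord =
  (quotient-connected surjective connected , quotient-collapsed surjective , quotient-closed ord closed-id) ,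
  λ 1<r → let _ , _ , ci₀<cj₀ = two-classes surjective 1<r
          in ClosedLabelings.hasExactly G cls connected closed-id exch ord ci₀<cj₀
  where open Classes G cls exch
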